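{- Let $X$ be a tournament on $n$ vertices. Then its Redei-Berge polynomial satisfies $u_X(-m)=(-1)^n u_X(m)$ as polynomials in $m$.
   Context: A digraph is a pair $X=(V,E)$ with $V$ finite and $E\subset\{(u,v)\in V\times V\mid u\ne v\}$; $n=|V|$. A tournament is a digraph in which for any two distinct vertices $u,v$ exactly one of $(u,v),(v,u)$ is in $E$. A $V$-listing is a bijection $\sigma:[n]\to V$; $\Sigma_V$ is the set of $V$-listings; $X\mathrm{Des}(\sigma)=\{1\le i\le n-1\mid(\sigma_i,\sigma_{i+1})\in E\}$. For $I\subset[n-1]$, $F_I=\sum x_{i_1}\cdots x_{i_n}$ over $1\le i_1\le\cdots\le i_n$ with $i_j<i_{j+1}$ for $j\in I$. The Redei-Berge symmetric function is $U_X=\sum_{\sigma\in\Sigma_V}F_{X\mathrm{Des}(\sigma)}$ and the Redei-Berge polynomial is $u_X(m)=U_X(1,\dots,1,0,0,\dots)$ with $m$ ones, a polynomial in $m$. -}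

module Defs where

open import Data.Nat using (ℕ; zero; suc)
open import Data.Bool using (Bool; true; false; not; _∧_; _∨_; if_then_else_)
open import Data.Fin using (Fin; zero; suc; _≤?_; _<?_; _≟_)
open import Data.List using (List; []; _∷_; map; concatMap; filter; length; allFin; foldr)
open import Data.Nat.ListAction using (sum)
open import Data.Integer using (+_)
open import Data.Rational using (ℚ; _/_; _+_; _*_; -_; 0ℚ; 1ℚ)
open import Relation.Nullary.Decidable using (⌊_⌋)
open import Relation.Binary.PropositionalEquality using (_≡_; _≢_)

record Digraph (n : ℕ) : Set where
  field
    edge     : Fin n → Fin n → Bool
    loopless : ∀ u → edge u u ≡ false
open Digraph public

IsTournament : ∀ {n} → Digraph n → Set
IsTournament {n} X = ∀ (u v : Fin n) → u ≢ v → edge X v u ≡ not (edge X u v)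

words : ℕ → (m : ℕ) → List (List (Fin m))
words zero    m = [] ∷ []
words (suc k) m = concatMap (λ w → map (λ a → a ∷ w) (allFin m)) (words k m)

elem : ∀ {n} → Fin n → List (Fin n) → Bool
elem a []       = false
elem a (b ∷ bs) = ⌊ a ≟ b ⌋ ∨ elem a bs

distinct : ∀ {n} → List (Fin n) → Bool
distinct []       = true
distinct (a ∷ as) = not (elem a as) ∧ distinct as

-- V-listings σ : [n] → V (bijections), written as the word σ₁ σ₂ … σₙ:
-- words of length n over V = Fin n with no repeated letter.
listings : (n : ℕ) → List (List (Fin n))
listings n = filter (λ w → T? (distinct w)) (words n n)
  where
  open import Data.Bool using (T)
  open import Data.Bool.Properties using (T?)

-- F_{X Des(σ)}(1^m): the number of sequences 1 ≤ i₁ ≤ … ≤ iₙ ≤ m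
-- (here with values in Fin m, i.e. {0,…,m-1}, an order-preserving relabelling)
-- such that i_j < i_{j+1} whenever j ∈ X Des(σ), i.e. (σ_j, σ_{j+1}) ∈ E.

compatible : ∀ {n m} → Digraph n → List (Fin n) → List (Fin m) → Bool
compatible X (a ∷ b ∷ σ) (i ∷ j ∷ s) =
  (if edge X a b then ⌊ i <? j ⌋ else ⌊ i ≤? j ⌋) ∧ compatible X (b ∷ σ) (j ∷ s)
compatible X _ _ = true

FDes1 : ∀ {n} → Digraph n → List (Fin n) → (m : ℕ) → ℕ
FDes1 {n} X σ m = length (filter (λ s → T? (compatible X σ s)) (words n m))
  where
  open import Data.Bool.Properties using (T?)

-- Redei–Berge polynomial evaluated at m ∈ ℕ:  u_X(m) = Σ_σ F_{X Des(σ)}(1,…,1,0,…) (m ones)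
redeiBerge : ∀ {n} → Digraph n → ℕ → ℕ
redeiBerge {n} X m = sum (map (λ σ → FDes1 X σ m) (listings n))

-- Polynomials over ℚ as coefficient lists (constant term first)

Poly : Set
Poly = List ℚ

eval : Poly → ℚ → ℚ
eval p x = foldr (λ c acc → c + x * acc) 0ℚ p

ℕtoℚ : ℕ → ℚ
ℕtoℚ k = + k / 1

signℚ : ℕ → ℚ
signℚ zero    = 1ℚ
signℚ (suc k) = - signℚ k

module Submission where

-- Counting weakly increasing sequences that must increase strictly at the descents of σ gives
-- F_{X Des(σ)}(1^m) = C(m + d(σ), n), where d(σ) = n - 1 - |X Des(σ)| counts the non-descents of σ
-- (a hockey-stick induction along σ). So u_X is the polynomial Σ_σ C(x + d(σ), n).
-- Now C(-x + d, n) = (-1)^n C(x + n - 1 - d, n), and in a tournament each step of σ is a descent of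
-- exactly one of σ and its reverse, so n - 1 - d(σ) = d(reverse σ); reindexing the sum by reversal
-- gives u_X(-x) = (-1)^n u_X(x).

open import Defs
open import Data.Nat using (ℕ)
open import Data.Product using (Σ; _×_)
open import Data.Rational using (ℚ; _*_; -_)
open import Relation.Binary.PropositionalEquality using (_≡_)

open import Algebra.Bundles using (CommutativeSemigroup)
open import Algebra.Core using (Op₂)
open import Algebra.Structures using (IsCommutativeMonoid)
open import Data.Bool using (Bool; true; false; not; _∧_; _∨_; if_then_else_; T)
open import Data.Bool.Properties using (∧-identityʳ; ∧-zeroʳ; ∨-identityʳ; ∨-assoc; ∨-comm; T-∧)
open import Data.Empty using (⊥-elim)
open import Data.Fin as Fin using (Fin; toℕ; _≟_)
open import Data.Fin.Properties using (toℕ<n)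
open import Data.List using (List; []; _∷_; _++_; _∷ʳ_; map; concatMap; filter; foldr; length; reverse; allFin; tabulate)
open import Data.List.Properties using (map-++; map-∘; map-cong; map-cong-local; map-tabulate; unfold-reverse)
open import Data.List.Membership.Propositional using (_∈_; find)
open import Data.List.Membership.Propositional.Properties using (∈-filter⁻; ∈-concatMap⁻; ∈-map⁻)
open import Data.List.Relation.Unary.All as All using ()
open import Data.List.Relation.Unary.Any using (here)
open import Data.Nat.Base as ℕ using (zero; suc; _≤_; z≤n; s≤s; _!)
import Data.Nat.Properties as ℕₚ
open import Data.Nat.Combinatorics using (_C_; k>n⇒nCk≡0; nC1≡n; nCk+nC[k+1]≡[n+1]C[k+1])
open import Data.Nat.ListAction using (sum)
open import Data.Product using (_,_; proj₁; proj₂)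
open import Function using (_∘_; flip)
open import Function.Bundles using (_⇔_; Equivalence; mk⇔)
open import Relation.Binary.PropositionalEquality using (refl; sym; trans; cong; cong₂; _≢_; module ≡-Reasoning)
open import Relation.Nullary.Decidable using (Dec; ⌊_⌋; yes; no; T?; does-⇔; isYes≗does)

open ≡-Reasoning

⌊⌋-⇔ : ∀ {A B : Set} → A ⇔ B → (a? : Dec A) (b? : Dec B) → ⌊ a? ⌋ ≡ ⌊ b? ⌋
⌊⌋-⇔ A⇔B a? b? = trans (isYes≗does a?) (trans (does-⇔ A⇔B a? b?) (sym (isYes≗does b?)))

elem-∷ʳ : ∀ {n} (a b : Fin n) xs → elem a (xs ∷ʳ b) ≡ (elem a xs ∨ ⌊ a ≟ b ⌋)
elem-∷ʳ a b []       = ∨-identityʳ _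
elem-∷ʳ a b (x ∷ xs) = trans (cong (⌊ a ≟ x ⌋ ∨_) (elem-∷ʳ a b xs)) (sym (∨-assoc ⌊ a ≟ x ⌋ (elem a xs) _))

elem-reverse : ∀ {n} (a : Fin n) xs → elem a (reverse xs) ≡ elem a xs
elem-reverse a []       = refl
elem-reverse a (x ∷ xs) = begin
  elem a (reverse (x ∷ xs))        ≡⟨ cong (elem a) (unfold-reverse x xs) ⟩
  elem a (reverse xs ∷ʳ x)         ≡⟨ elem-∷ʳ a x (reverse xs) ⟩
  elem a (reverse xs) ∨ ⌊ a ≟ x ⌋  ≡⟨ cong (_∨ ⌊ a ≟ x ⌋) (elem-reverse a xs) ⟩
  elem a xs ∨ ⌊ a ≟ x ⌋            ≡⟨ ∨-comm (elem a xs) _ ⟩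
  ⌊ a ≟ x ⌋ ∨ elem a xs            ∎

distinct-∷ʳ : ∀ {n} (b : Fin n) xs → distinct (xs ∷ʳ b) ≡ (not (elem b xs) ∧ distinct xs)
distinct-∷ʳ b []       = refl
distinct-∷ʳ b (x ∷ xs) = begin
  not (elem x (xs ∷ʳ b)) ∧ distinct (xs ∷ʳ b)
    ≡⟨ cong₂ (λ u v → not u ∧ v) (elem-∷ʳ x b xs) (distinct-∷ʳ b xs) ⟩
  not (elem x xs ∨ ⌊ x ≟ b ⌋) ∧ (not (elem b xs) ∧ distinct xs)
    ≡⟨ rearrange (elem x xs) ⌊ x ≟ b ⌋ (elem b xs) (distinct xs) ⟩
  not (⌊ x ≟ b ⌋ ∨ elem b xs) ∧ (not (elem x xs) ∧ distinct xs)
    ≡⟨ cong (λ u → not (u ∨ elem b xs) ∧ (not (elem x xs) ∧ distinct xs)) (⌊⌋-⇔ (mk⇔ sym sym) (x ≟ b) (b ≟ x)) ⟩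
  not (⌊ b ≟ x ⌋ ∨ elem b xs) ∧ (not (elem x xs) ∧ distinct xs) ∎
  where
  rearrange : ∀ p q r s → not (p ∨ q) ∧ (not r ∧ s) ≡ not (q ∨ r) ∧ (not p ∧ s)
  rearrange false false false s = refl
  rearrange false false true  s = refl
  rearrange false true  false s = refl
  rearrange false true  true  s = refl
  rearrange true  false false s = refl
  rearrange true  false true  s = refl
  rearrange true  true  false s = refl
  rearrange true  true  true  s = refl

distinct-reverse : ∀ {n} (xs : List (Fin n)) → distinct (reverse xs) ≡ distinct xs
distinct-reverse []       = refl
distinct-reverse (x ∷ xs) = begin
  distinct (reverse (x ∷ xs))                        ≡⟨ cong distinct (unfold-reverse x xs) ⟩
  distinct (reverse xs ∷ʳ x)                         ≡⟨ distinct-∷ʳ x (reverse xs) ⟩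
  not (elem x (reverse xs)) ∧ distinct (reverse xs) ≡⟨ cong₂ (λ u v → not u ∧ v) (elem-reverse x xs) (distinct-reverse xs) ⟩
  not (elem x xs) ∧ distinct xs                      ∎

distinct⇒head≢ : ∀ {n} {a b : Fin n} σ → T (distinct (a ∷ b ∷ σ)) → a ≢ b
distinct⇒head≢ {a = a} {b} σ d with a ≟ b
... | yes _   = ⊥-elim d
... | no  a≢b = a≢b

distinct⇒tail : ∀ {n} (a : Fin n) σ → T (distinct (a ∷ σ)) → T (distinct σ)
distinct⇒tail a σ d = proj₂ (Equivalence.to T-∧ d)

module ListSum {A : Set} {_∙_ : Op₂ A} {ε : A} (isCommutativeMonoid : IsCommutativeMonoid _≡_ _∙_ ε) where

  open IsCommutativeMonoid isCommutativeMonoid using (assoc; identityˡ; isCommutativeSemigroup)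

  private
    commutativeSemigroup : CommutativeSemigroup _ _
    commutativeSemigroup = record { isCommutativeSemigroup = isCommutativeSemigroup }

  open import Algebra.Properties.CommutativeSemigroup commutativeSemigroup using (interchange)

  ∑ : List A → A
  ∑ = foldr _∙_ ε

  ∑-++ : (xs ys : List A) → ∑ (xs ++ ys) ≡ ∑ xs ∙ ∑ ys
  ∑-++ []       ys = sym (identityˡ _)
  ∑-++ (x ∷ xs) ys = trans (cong (x ∙_) (∑-++ xs ys)) (sym (assoc x _ _))

  ∑-concatMap : ∀ {B C : Set} (f : C → A) (g : B → List C) (l : List B) →
    ∑ (map f (concatMap g l)) ≡ ∑ (map (λ b → ∑ (map f (g b))) l)
  ∑-concatMap f g []      = refl
  ∑-concatMap f g (b ∷ l) = begin
    ∑ (map f (g b ++ concatMap g l))               ≡⟨ cong ∑ (map-++ f (g b) (concatMap g l)) ⟩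
    ∑ (map f (g b) ++ map f (concatMap g l))       ≡⟨ ∑-++ (map f (g b)) _ ⟩
    ∑ (map f (g b)) ∙ ∑ (map f (concatMap g l))    ≡⟨ cong (∑ (map f (g b)) ∙_) (∑-concatMap f g l) ⟩
    ∑ (map f (g b)) ∙ ∑ (map (λ b → ∑ (map f (g b))) l) ∎

  ∑-ε : ∀ {B : Set} (f : B → A) → (∀ x → f x ≡ ε) → ∀ l → ∑ (map f l) ≡ ε
  ∑-ε f f≡ε []      = refl
  ∑-ε f f≡ε (x ∷ l) = trans (cong₂ _∙_ (f≡ε x) (∑-ε f f≡ε l)) (identityˡ ε)

  ∑-∙ : ∀ {B : Set} (f g : B → A) → ∀ l → ∑ (map (λ x → f x ∙ g x) l) ≡ ∑ (map f l) ∙ ∑ (map g l)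
  ∑-∙ f g []      = sym (identityˡ ε)
  ∑-∙ f g (x ∷ l) = trans (cong ((f x ∙ g x) ∙_) (∑-∙ f g l)) (interchange (f x) (g x) _ _)

  ∑-swap : ∀ {B C : Set} (F : B → C → A) (l₁ : List B) (l₂ : List C) →
    ∑ (map (λ b → ∑ (map (F b) l₂)) l₁) ≡ ∑ (map (λ c → ∑ (map (λ b → F b c) l₁)) l₂)
  ∑-swap F []       l₂ = sym (∑-ε _ (λ _ → refl) l₂)
  ∑-swap F (b ∷ l₁) l₂ = trans (cong (∑ (map (F b) l₂) ∙_) (∑-swap F l₁ l₂))
                               (sym (∑-∙ (F b) (λ c → ∑ (map (λ b → F b c) l₁)) l₂))

  ∑-filter : ∀ {B : Set} (P : B → Bool) (f : B → A) (l : List B) →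
    ∑ (map f (filter (λ x → T? (P x)) l)) ≡ ∑ (map (λ x → if P x then f x else ε) l)
  ∑-filter P f []      = refl
  ∑-filter P f (x ∷ l) with P x
  ... | true  = cong (f x ∙_) (∑-filter P f l)
  ... | false = trans (∑-filter P f l) (sym (identityˡ _))

  ∑-if-∧ : ∀ {B : Set} (c : Bool) (P : B → Bool) (f : B → A) (l : List B) →
    ∑ (map (λ x → if P x ∧ c then f x else ε) l) ≡ (if c then ∑ (map (λ x → if P x then f x else ε) l) else ε)
  ∑-if-∧ true  P f l = cong ∑ (map-cong (λ x → cong (if_then f x else ε) (∧-identityʳ (P x))) l)
  ∑-if-∧ false P f l = ∑-ε _ (λ x → cong (if_then f x else ε) (∧-zeroʳ (P x))) l

  ∑-cong-∈ : ∀ {B : Set} {f g : B → A} (l : List B) → (∀ {x} → x ∈ l → f x ≡ g x) → ∑ (map f l) ≡ ∑ (map g l)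
  ∑-cong-∈ l f≡g = cong ∑ (map-cong-local (All.tabulate f≡g))

  ∑-words-suc : ∀ k m (f : List (Fin m) → A) →
    ∑ (map f (words (suc k) m)) ≡ ∑ (map (λ v → ∑ (map (λ a → f (a ∷ v)) (allFin m))) (words k m))
  ∑-words-suc k m f = trans (∑-concatMap f (λ v → map (_∷ v) (allFin m)) (words k m))
                            (cong ∑ (map-cong (λ v → cong ∑ (sym (map-∘ (allFin m)))) (words k m)))

  ∑-words-∷ʳ : ∀ k m (f : List (Fin m) → A) →
    ∑ (map f (words (suc k) m)) ≡ ∑ (map (λ v → ∑ (map (λ a → f (v ∷ʳ a)) (allFin m))) (words k m))
  ∑-words-∷ʳ zero    m f = ∑-words-suc zero m f
  ∑-words-∷ʳ (suc k) m f = begin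
    ∑ (map f (words (suc (suc k)) m))
      ≡⟨ ∑-words-suc (suc k) m f ⟩
    ∑ (map (λ u → ∑ (map (λ b → f (b ∷ u)) (allFin m))) (words (suc k) m))
      ≡⟨ ∑-words-∷ʳ k m _ ⟩
    ∑ (map (λ v → ∑ (map (λ a → ∑ (map (λ b → f (b ∷ v ∷ʳ a)) (allFin m))) (allFin m))) (words k m))
      ≡⟨ cong ∑ (map-cong (λ v → ∑-swap (λ a b → f (b ∷ v ∷ʳ a)) (allFin m) (allFin m)) (words k m)) ⟩
    ∑ (map (λ v → ∑ (map (λ b → ∑ (map (λ a → f (b ∷ v ∷ʳ a)) (allFin m))) (allFin m))) (words k m))
      ≡⟨ ∑-words-suc k m _ ⟨
    ∑ (map (λ u → ∑ (map (λ a → f (u ∷ʳ a)) (allFin m))) (words (suc k) m)) ∎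

  ∑-words-reverse : ∀ k m (f : List (Fin m) → A) →
    ∑ (map (f ∘ reverse) (words k m)) ≡ ∑ (map f (words k m))
  ∑-words-reverse zero    m f = refl
  ∑-words-reverse (suc k) m f = begin
    ∑ (map (f ∘ reverse) (words (suc k) m))
      ≡⟨ ∑-words-suc k m _ ⟩
    ∑ (map (λ v → ∑ (map (λ a → f (reverse (a ∷ v))) (allFin m))) (words k m))
      ≡⟨ cong ∑ (map-cong (λ v → cong ∑ (map-cong (λ a → cong f (unfold-reverse a v)) (allFin m))) (words k m)) ⟩
    ∑ (map ((λ u → ∑ (map (λ a → f (u ∷ʳ a)) (allFin m))) ∘ reverse) (words k m))
      ≡⟨ ∑-words-reverse k m _ ⟩
    ∑ (map (λ v → ∑ (map (λ a → f (v ∷ʳ a)) (allFin m))) (words k m))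
      ≡⟨ ∑-words-∷ʳ k m f ⟨
    ∑ (map f (words (suc k) m)) ∎

  ∑-listings-reverse : ∀ n (f : List (Fin n) → A) →
    ∑ (map (f ∘ reverse) (listings n)) ≡ ∑ (map f (listings n))
  ∑-listings-reverse n f = begin
    ∑ (map (f ∘ reverse) (listings n))
      ≡⟨ ∑-filter distinct _ (words n n) ⟩
    ∑ (map (λ w → if distinct w then f (reverse w) else ε) (words n n))
      ≡⟨ cong ∑ (map-cong (λ w → cong (if_then f (reverse w) else ε) (sym (distinct-reverse w))) (words n n)) ⟩
    ∑ (map (restrict ∘ reverse) (words n n))
      ≡⟨ ∑-words-reverse n n restrict ⟩
    ∑ (map restrict (words n n))
      ≡⟨ ∑-filter distinct f (words n n) ⟨
    ∑ (map f (listings n)) ∎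
    where
    restrict : List (Fin n) → A
    restrict w = if distinct w then f w else ε

∈-words⇒length : ∀ k m {w} → w ∈ words k m → length w ≡ k
∈-words⇒length zero    m (here refl) = refl
∈-words⇒length (suc k) m w∈ with find (∈-concatMap⁻ (λ v → map (_∷ v) (allFin m)) {xs = words k m} w∈)
... | v , v∈ , w∈′ with ∈-map⁻ (_∷ v) w∈′
... | _ , _ , refl = cong suc (∈-words⇒length k m v∈)

∈-listings⁻ : ∀ n {σ} → σ ∈ listings n → length σ ≡ n × T (distinct σ)
∈-listings⁻ n σ∈ with ∈-filter⁻ (λ w → T? (distinct w)) {xs = words n n} σ∈
... | σ∈words , d = ∈-words⇒length n n σ∈words , d

module Binomial where

  open import Data.Nat.Base using (_+_; _<ᵇ_)
  open import Algebra.Properties.CommutativeSemigroup ℕₚ.+-commutativeSemigroup using (xy∙z≈y∙xz)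
  open import Data.Nat.Solver using (module +-*-Solver)
  open +-*-Solver

  sumBelow : ℕ → (ℕ → ℕ) → ℕ
  sumBelow zero    g = 0
  sumBelow (suc t) g = g 0 + sumBelow t (g ∘ suc)

  sumBelow-cong : ∀ t {f g : ℕ → ℕ} → (∀ x → f x ≡ g x) → sumBelow t f ≡ sumBelow t g
  sumBelow-cong zero    f≡g = refl
  sumBelow-cong (suc t) f≡g = cong₂ _+_ (f≡g 0) (sumBelow-cong t (f≡g ∘ suc))

  sumBelow-0 : ∀ t → sumBelow t (λ _ → 0) ≡ 0
  sumBelow-0 zero    = refl
  sumBelow-0 (suc t) = sumBelow-0 t

  sum-allFin : ∀ m (g : ℕ → ℕ) → sum (map (g ∘ toℕ) (allFin m)) ≡ sumBelow m g
  sum-allFin m g = trans (cong sum (map-tabulate {n = m} (λ i → i) (g ∘ toℕ))) (sum-tabulate m g)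
    where
    sum-tabulate : ∀ m (g : ℕ → ℕ) → sum (tabulate {n = m} (g ∘ toℕ)) ≡ sumBelow m g
    sum-tabulate zero    g = refl
    sum-tabulate (suc m) g = cong (g 0 +_) (sum-tabulate m (g ∘ suc))

  sumBelow-restrict : ∀ {t m} → t ≤ m → (g : ℕ → ℕ) →
    sumBelow m (λ x → if x <ᵇ t then g x else 0) ≡ sumBelow t g
  sumBelow-restrict {m = m} z≤n       g = sumBelow-0 m
  sumBelow-restrict         (s≤s t≤m) g = cong (g 0 +_) (sumBelow-restrict t≤m (g ∘ suc))

  hockeyStick : ∀ N w i → w ≤ i → sumBelow N (λ x → (x + w) C i) ≡ (N + w) C suc i
  hockeyStick N w i w≤i = begin
    sumBelow N (λ x → (x + w) C i)              ≡⟨ ℕₚ.+-identityʳ _ ⟨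
    sumBelow N (λ x → (x + w) C i) + 0          ≡⟨ cong (sumBelow N (λ x → (x + w) C i) +_) (k>n⇒nCk≡0 (s≤s w≤i)) ⟨
    sumBelow N (λ x → (x + w) C i) + w C suc i  ≡⟨ withInitialTerm N w ⟩
    (N + w) C suc i                             ∎
    where
    withInitialTerm : ∀ N w → sumBelow N (λ x → (x + w) C i) + w C suc i ≡ (N + w) C suc i
    withInitialTerm zero    w = refl
    withInitialTerm (suc N) w = begin
      (w C i + sumBelow N (λ x → (suc x + w) C i)) + w C suc i
        ≡⟨ cong (λ s → (w C i + s) + w C suc i) (sumBelow-cong N (λ x → cong (_C i) (sym (ℕₚ.+-suc x w)))) ⟩
      (w C i + sumBelow N (λ x → (x + suc w) C i)) + w C suc i
        ≡⟨ xy∙z≈y∙xz (w C i) _ (w C suc i) ⟩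
      sumBelow N (λ x → (x + suc w) C i) + (w C i + w C suc i)
        ≡⟨ cong (sumBelow N (λ x → (x + suc w) C i) +_) (nCk+nC[k+1]≡[n+1]C[k+1] w i) ⟩
      sumBelow N (λ x → (x + suc w) C i) + suc w C suc i
        ≡⟨ withInitialTerm N (suc w) ⟩
      (N + suc w) C suc i
        ≡⟨ cong (_C suc i) (ℕₚ.+-suc N w) ⟩
      (suc N + w) C suc i ∎

  [1+k]*[1+N]C[1+k]≡[1+N]*NCk : ∀ N k → suc k ℕ.* (suc N C suc k) ≡ suc N ℕ.* (N C k)
  [1+k]*[1+N]C[1+k]≡[1+N]*NCk zero    zero    = refl
  [1+k]*[1+N]C[1+k]≡[1+N]*NCk zero    (suc k) = ℕₚ.*-zeroʳ (suc (suc k))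
  [1+k]*[1+N]C[1+k]≡[1+N]*NCk (suc N) zero    = trans (ℕₚ.+-identityʳ _) (trans (nC1≡n (suc (suc N))) (sym (ℕₚ.*-identityʳ _)))
  [1+k]*[1+N]C[1+k]≡[1+N]*NCk (suc N) (suc k) = begin
    suc (suc k) ℕ.* (suc (suc N) C suc (suc k))
      ≡⟨ cong (suc (suc k) ℕ.*_) (sym (nCk+nC[k+1]≡[n+1]C[k+1] (suc N) (suc k))) ⟩
    suc (suc k) ℕ.* (A + B)
      ≡⟨ solve 3 (λ k A B → (con 2 :+ k) :* (A :+ B) := A :+ ((con 1 :+ k) :* A :+ (con 2 :+ k) :* B)) refl k A B ⟩
    A + (suc k ℕ.* A + suc (suc k) ℕ.* B)
      ≡⟨ cong (A +_) (cong₂ _+_ ([1+k]*[1+N]C[1+k]≡[1+N]*NCk N k) ([1+k]*[1+N]C[1+k]≡[1+N]*NCk N (suc k))) ⟩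
    A + (suc N ℕ.* (N C k) + suc N ℕ.* (N C suc k))
      ≡⟨ cong (A +_) (sym (ℕₚ.*-distribˡ-+ (suc N) (N C k) _)) ⟩
    A + suc N ℕ.* (N C k + N C suc k)
      ≡⟨ cong (λ s → A + suc N ℕ.* s) (nCk+nC[k+1]≡[n+1]C[k+1] N k) ⟩
    suc (suc N) ℕ.* A ∎
    where
    A = suc N C suc k
    B = suc N C suc (suc k)

  [1+k]!*[1+N]C[1+k]≡[1+N]*[k!*NCk] : ∀ N k → suc k ! ℕ.* (suc N C suc k) ≡ suc N ℕ.* (k ! ℕ.* (N C k))
  [1+k]!*[1+N]C[1+k]≡[1+N]*[k!*NCk] N k = begin
    (suc k ℕ.* k !) ℕ.* (suc N C suc k) ≡⟨ solve 3 (λ k f c → (k :* f) :* c := f :* (k :* c)) refl (suc k) (k !) _ ⟩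
    k ! ℕ.* (suc k ℕ.* (suc N C suc k)) ≡⟨ cong (k ! ℕ.*_) ([1+k]*[1+N]C[1+k]≡[1+N]*NCk N k) ⟩
    k ! ℕ.* (suc N ℕ.* (N C k))         ≡⟨ solve 3 (λ f n c → f :* (n :* c) := n :* (f :* c)) refl (k !) (suc N) _ ⟩
    suc N ℕ.* (k ! ℕ.* (N C k))         ∎

open Binomial

module Descents where

  open import Data.Nat.Base using (_+_)
  open import Algebra.Properties.CommutativeSemigroup ℕₚ.+-commutativeSemigroup using (interchange)

  slack : Bool → ℕ
  slack true  = 0
  slack false = 1

  nonDescents : ∀ {n} → (Fin n → Fin n → Bool) → List (Fin n) → ℕ
  nonDescents E (a ∷ b ∷ σ) = slack (E a b) + nonDescents E (b ∷ σ)
  nonDescents E _           = 0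

  nonDescents-∷ʳ : ∀ {n} (E : Fin n → Fin n → Bool) xs b a →
    nonDescents E (xs ∷ʳ b ∷ʳ a) ≡ nonDescents E (xs ∷ʳ b) + slack (E b a)
  nonDescents-∷ʳ E []           b a = ℕₚ.+-identityʳ _
  nonDescents-∷ʳ E (x ∷ [])     b a =
    trans (cong (slack (E x b) +_) (ℕₚ.+-identityʳ _)) (cong (_+ slack (E b a)) (sym (ℕₚ.+-identityʳ _)))
  nonDescents-∷ʳ E (x ∷ y ∷ xs) b a =
    trans (cong (slack (E x y) +_) (nonDescents-∷ʳ E (y ∷ xs) b a)) (sym (ℕₚ.+-assoc (slack (E x y)) _ _))

  nonDescents-reverse : ∀ {n} (E : Fin n → Fin n → Bool) σ → nonDescents E (reverse σ) ≡ nonDescents (flip E) σ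
  nonDescents-reverse E []          = refl
  nonDescents-reverse E (a ∷ [])    = refl
  nonDescents-reverse E (a ∷ b ∷ σ) = begin
    nonDescents E (reverse (a ∷ b ∷ σ))
      ≡⟨ cong (nonDescents E) (trans (unfold-reverse a (b ∷ σ)) (cong (_∷ʳ a) (unfold-reverse b σ))) ⟩
    nonDescents E (reverse σ ∷ʳ b ∷ʳ a)
      ≡⟨ nonDescents-∷ʳ E (reverse σ) b a ⟩
    nonDescents E (reverse σ ∷ʳ b) + slack (E b a)
      ≡⟨ cong (λ τ → nonDescents E τ + slack (E b a)) (unfold-reverse b σ) ⟨
    nonDescents E (reverse (b ∷ σ)) + slack (E b a)
      ≡⟨ cong (_+ slack (E b a)) (nonDescents-reverse E (b ∷ σ)) ⟩
    nonDescents (flip E) (b ∷ σ) + slack (E b a)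
      ≡⟨ ℕₚ.+-comm _ (slack (E b a)) ⟩
    nonDescents (flip E) (a ∷ b ∷ σ) ∎

  slack-+-not : ∀ e → slack e + slack (not e) ≡ 1
  slack-+-not true  = refl
  slack-+-not false = refl

  nonDescents-+-flip : ∀ {n} (X : Digraph n) → IsTournament X → ∀ a σ → T (distinct (a ∷ σ)) →
    nonDescents (edge X) (a ∷ σ) + nonDescents (flip (edge X)) (a ∷ σ) ≡ length σ
  nonDescents-+-flip X tournament a []      d = refl
  nonDescents-+-flip X tournament a (b ∷ σ) d = begin
    (e + D) + (slack (edge X b a) + D′)
      ≡⟨ cong (λ e′ → (e + D) + (slack e′ + D′)) (tournament a b (distinct⇒head≢ σ d)) ⟩
    (e + D) + (slack (not (edge X a b)) + D′)
      ≡⟨ interchange e D _ D′ ⟩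
    (e + slack (not (edge X a b))) + (D + D′)
      ≡⟨ cong₂ _+_ (slack-+-not (edge X a b)) (nonDescents-+-flip X tournament b σ (distinct⇒tail a (b ∷ σ) d)) ⟩
    suc (length σ) ∎
    where
    e  = slack (edge X a b)
    D  = nonDescents (edge X) (b ∷ σ)
    D′ = nonDescents (flip (edge X)) (b ∷ σ)

  nonDescents-+-reverse : ∀ {n} (X : Digraph n) → IsTournament X → ∀ a σ → T (distinct (a ∷ σ)) →
    nonDescents (edge X) (a ∷ σ) + nonDescents (edge X) (reverse (a ∷ σ)) ≡ length σ
  nonDescents-+-reverse X tournament a σ d =
    trans (cong (nonDescents (edge X) (a ∷ σ) +_) (nonDescents-reverse (edge X) (a ∷ σ))) (nonDescents-+-flip X tournament a σ d)

open Descents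

module Counting where

  open import Data.Nat.Base using (_+_; _<ᵇ_; _≤ᵇ_)
  open import Algebra.Properties.CommutativeSemigroup ℕₚ.+-commutativeSemigroup using (xy∙z≈y∙xz)
  open import Data.Nat.Solver using (module +-*-Solver)
  open +-*-Solver
  open ListSum ℕₚ.+-0-isCommutativeMonoid

  ≤ᵇ≡<ᵇsuc : ∀ x y → (x ≤ᵇ y) ≡ (x <ᵇ suc y)
  ≤ᵇ≡<ᵇsuc zero    y = refl
  ≤ᵇ≡<ᵇsuc (suc x) y = refl

  stepCondition : ∀ {m} → Bool → Fin m → Fin m → Bool
  stepCondition e i j = if e then ⌊ i Fin.<? j ⌋ else ⌊ i Fin.≤? j ⌋

  stepCondition≡<ᵇ : ∀ {m} e (i j : Fin m) → stepCondition e i j ≡ (toℕ i <ᵇ slack e + toℕ j)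
  stepCondition≡<ᵇ true  i j = isYes≗does (i Fin.<? j)
  stepCondition≡<ᵇ false i j = trans (isYes≗does (i Fin.≤? j)) (≤ᵇ≡<ᵇsuc (toℕ i) (toℕ j))

  sum-stepCondition : ∀ {m} e (j : Fin m) (g : ℕ → ℕ) →
    ∑ (map (λ i → if stepCondition e i j then g (toℕ i) else 0) (allFin m)) ≡ sumBelow (slack e + toℕ j) g
  sum-stepCondition {m} e j g = begin
    ∑ (map (λ i → if stepCondition e i j then g (toℕ i) else 0) (allFin m))
      ≡⟨ cong ∑ (map-cong (λ i → cong (if_then g (toℕ i) else 0) (stepCondition≡<ᵇ e i j)) (allFin m)) ⟩
    ∑ (map (λ i → if toℕ i <ᵇ slack e + toℕ j then g (toℕ i) else 0) (allFin m))
      ≡⟨ sum-allFin m _ ⟩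
    sumBelow m (λ x → if x <ᵇ slack e + toℕ j then g x else 0)
      ≡⟨ sumBelow-restrict (bound e) g ⟩
    sumBelow (slack e + toℕ j) g ∎
    where
    bound : ∀ e → slack e + toℕ j ≤ m
    bound true  = ℕₚ.<⇒≤ (toℕ<n j)
    bound false = toℕ<n j

  module _ {n : ℕ} (X : Digraph n) where

    -- Weighting the first letter lets the count recurse along σ: summing out the first
    -- letter replaces the weight by its partial sums (headSum-∷∷).
    headSum : (m k : ℕ) → List (Fin n) → (ℕ → ℕ) → ℕ
    headSum m k σ g = ∑ (map (λ v → ∑ (map (λ i → if compatible X σ (i ∷ v) then g (toℕ i) else 0) (allFin m))) (words k m))

    headSum-cong : ∀ m k σ {g h : ℕ → ℕ} → (∀ x → g x ≡ h x) → headSum m k σ g ≡ headSum m k σ h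
    headSum-cong m k σ g≡h =
      cong ∑ (map-cong (λ v → cong ∑ (map-cong (λ i → cong (if compatible X σ (i ∷ v) then_else 0) (g≡h (toℕ i))) (allFin m))) (words k m))

    headSum-∷∷ : ∀ m k a b σ g →
      headSum m (suc k) (a ∷ b ∷ σ) g ≡ headSum m k (b ∷ σ) (λ y → sumBelow (slack (edge X a b) + y) g)
    headSum-∷∷ m k a b σ g = begin
      headSum m (suc k) (a ∷ b ∷ σ) g
        ≡⟨ ∑-words-suc k m _ ⟩
      ∑ (map (λ v → ∑ (map (λ j → ∑ (map (λ i → if stepCondition (edge X a b) i j ∧ c j v then g (toℕ i) else 0) (allFin m))) (allFin m))) (words k m))
        ≡⟨ cong ∑ (map-cong (λ v → cong ∑ (map-cong (sumOverFirst v) (allFin m))) (words k m)) ⟩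
      headSum m k (b ∷ σ) (λ y → sumBelow (slack (edge X a b) + y) g) ∎
      where
      c : Fin m → List (Fin m) → Bool
      c j v = compatible X (b ∷ σ) (j ∷ v)
      sumOverFirst : ∀ v j → ∑ (map (λ i → if stepCondition (edge X a b) i j ∧ c j v then g (toℕ i) else 0) (allFin m))
                           ≡ (if c j v then sumBelow (slack (edge X a b) + toℕ j) g else 0)
      sumOverFirst v j = trans (∑-if-∧ (c j v) (λ i → stepCondition (edge X a b) i j) (g ∘ toℕ) (allFin m))
                               (cong (if c j v then_else 0) (sum-stepCondition (edge X a b) j g))

    headSum-binomial : ∀ m a σ w i → w ≤ i →
      headSum m (length σ) (a ∷ σ) (λ x → (x + w) C i) ≡ (m + w + nonDescents (edge X) (a ∷ σ)) C suc (length σ + i)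
    headSum-binomial m a []      w i w≤i = begin
      ∑ (map (λ j → (toℕ j + w) C i) (allFin m)) + 0 ≡⟨ ℕₚ.+-identityʳ _ ⟩
      ∑ (map (λ j → (toℕ j + w) C i) (allFin m))     ≡⟨ sum-allFin m _ ⟩
      sumBelow m (λ x → (x + w) C i)                  ≡⟨ hockeyStick m w i w≤i ⟩
      (m + w) C suc i                                 ≡⟨ cong (_C suc i) (ℕₚ.+-identityʳ (m + w)) ⟨
      (m + w + 0) C suc i ∎
    headSum-binomial m a (b ∷ σ) w i w≤i = begin
      headSum m (suc (length σ)) (a ∷ b ∷ σ) (λ x → (x + w) C i)
        ≡⟨ headSum-∷∷ m (length σ) a b σ _ ⟩
      headSum m (length σ) (b ∷ σ) (λ y → sumBelow (e + y) (λ x → (x + w) C i))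
        ≡⟨ headSum-cong m (length σ) (b ∷ σ) (λ y → trans (hockeyStick (e + y) w i w≤i) (cong (_C suc i) (xy∙z≈y∙xz e y w))) ⟩
      headSum m (length σ) (b ∷ σ) (λ y → (y + (e + w)) C suc i)
        ≡⟨ headSum-binomial m b σ (e + w) (suc i) (e+w≤1+i (edge X a b)) ⟩
      (m + (e + w) + nonDescents (edge X) (b ∷ σ)) C suc (length σ + suc i)
        ≡⟨ cong₂ _C_ (solve 4 (λ m e w d → m :+ (e :+ w) :+ d := m :+ w :+ (e :+ d)) refl m e w _) (cong suc (ℕₚ.+-suc (length σ) i)) ⟩
      (m + w + nonDescents (edge X) (a ∷ b ∷ σ)) C suc (suc (length σ) + i) ∎
      where
      e = slack (edge X a b)
      e+w≤1+i : ∀ b → slack b + w ≤ suc i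
      e+w≤1+i true  = ℕₚ.m≤n⇒m≤1+n w≤i
      e+w≤1+i false = s≤s w≤i

  length-filter : ∀ {B : Set} (P : B → Bool) (l : List B) →
    length (filter (λ x → T? (P x)) l) ≡ ∑ (map (λ x → if P x then 1 else 0) l)
  length-filter P []      = refl
  length-filter P (x ∷ l) with P x
  ... | true  = cong suc (length-filter P l)
  ... | false = length-filter P l

  FDes1≡C : ∀ {n} (X : Digraph n) σ m → length σ ≡ n → FDes1 X σ m ≡ (m + nonDescents (edge X) σ) C n
  FDes1≡C {zero}  X []      m _  = refl
  FDes1≡C {suc k} X (a ∷ σ) m eq = begin
    FDes1 X (a ∷ σ) m
      ≡⟨ length-filter (compatible X (a ∷ σ)) (words (suc k) m) ⟩
    ∑ (map (λ s → if compatible X (a ∷ σ) s then 1 else 0) (words (suc k) m))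
      ≡⟨ ∑-words-suc k m _ ⟩
    -- the weight (x + 0) C 0 computes to 1
    headSum X m k (a ∷ σ) (λ x → (x + 0) C 0)
      ≡⟨ cong (λ k → headSum X m k (a ∷ σ) _) (sym ∣σ∣≡k) ⟩
    headSum X m (length σ) (a ∷ σ) (λ x → (x + 0) C 0)
      ≡⟨ headSum-binomial X m a σ 0 0 z≤n ⟩
    (m + 0 + nonDescents (edge X) (a ∷ σ)) C suc (length σ + 0)
      ≡⟨ cong₂ (λ x y → (x + nonDescents (edge X) (a ∷ σ)) C suc y) (ℕₚ.+-identityʳ m) (trans (ℕₚ.+-identityʳ (length σ)) ∣σ∣≡k) ⟩
    (m + nonDescents (edge X) (a ∷ σ)) C suc k ∎
    where
    ∣σ∣≡k : length σ ≡ k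
    ∣σ∣≡k = ℕₚ.suc-injective eq

open Counting

module ℕtoℚ-Properties where

  open import Data.Rational using (_+_; _/_; 1ℚ; mkℚ)
  import Data.Rational.Properties as ℚₚ
  open import Data.Integer.Base as ℤ using ()
  import Data.Integer.Properties as ℤₚ
  open import Data.Nat.Coprimality using (1-coprimeTo) renaming (sym to coprime-sym)
  open import Data.Rational.Solver using (module +-*-Solver)
  open +-*-Solver
  open ListSum ℚₚ.+-0-isCommutativeMonoid

  ℕtoℚ≡mkℚ : ∀ k → ℕtoℚ k ≡ mkℚ (ℤ.+ k) 0 (coprime-sym (1-coprimeTo k))
  ℕtoℚ≡mkℚ k = ℚₚ.normalize-coprime _

  ℕtoℚ-suc : ∀ k → ℕtoℚ (suc k) ≡ 1ℚ + ℕtoℚ k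
  ℕtoℚ-suc k rewrite ℕtoℚ≡mkℚ k = cong (λ z → (ℤ.+ 1 ℤ.+ z) / 1) (sym (ℤₚ.*-identityʳ (ℤ.+ k)))

  ℕtoℚ-+ : ∀ a b → ℕtoℚ (a ℕ.+ b) ≡ ℕtoℚ a + ℕtoℚ b
  ℕtoℚ-+ zero    b = sym (ℚₚ.+-identityˡ _)
  ℕtoℚ-+ (suc a) b = begin
    ℕtoℚ (suc (a ℕ.+ b))      ≡⟨ ℕtoℚ-suc (a ℕ.+ b) ⟩
    1ℚ + ℕtoℚ (a ℕ.+ b)       ≡⟨ cong (1ℚ +_) (ℕtoℚ-+ a b) ⟩
    1ℚ + (ℕtoℚ a + ℕtoℚ b)    ≡⟨ ℚₚ.+-assoc 1ℚ (ℕtoℚ a) (ℕtoℚ b) ⟨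
    (1ℚ + ℕtoℚ a) + ℕtoℚ b    ≡⟨ cong (_+ ℕtoℚ b) (ℕtoℚ-suc a) ⟨
    ℕtoℚ (suc a) + ℕtoℚ b     ∎

  ℕtoℚ-* : ∀ a b → ℕtoℚ (a ℕ.* b) ≡ ℕtoℚ a * ℕtoℚ b
  ℕtoℚ-* zero    b = sym (ℚₚ.*-zeroˡ (ℕtoℚ b))
  ℕtoℚ-* (suc a) b = begin
    ℕtoℚ (b ℕ.+ a ℕ.* b)           ≡⟨ ℕtoℚ-+ b (a ℕ.* b) ⟩
    ℕtoℚ b + ℕtoℚ (a ℕ.* b)        ≡⟨ cong (ℕtoℚ b +_) (ℕtoℚ-* a b) ⟩
    ℕtoℚ b + ℕtoℚ a * ℕtoℚ b       ≡⟨ solve 2 (λ a b → b :+ a :* b := (con 1ℚ :+ a) :* b) refl (ℕtoℚ a) (ℕtoℚ b) ⟩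
    (1ℚ + ℕtoℚ a) * ℕtoℚ b         ≡⟨ cong (_* ℕtoℚ b) (ℕtoℚ-suc a) ⟨
    ℕtoℚ (suc a) * ℕtoℚ b          ∎

  ℕtoℚ-sum : ∀ {B : Set} (f : B → ℕ) l → ℕtoℚ (sum (map f l)) ≡ ∑ (map (ℕtoℚ ∘ f) l)
  ℕtoℚ-sum f []      = refl
  ℕtoℚ-sum f (x ∷ l) = trans (ℕtoℚ-+ (f x) _) (cong (ℕtoℚ (f x) +_) (ℕtoℚ-sum f l))

open ℕtoℚ-Properties

module FallingFactorial where

  open import Data.Rational using (_+_; _-_; 0ℚ; 1ℚ)
  import Data.Rational.Properties as ℚₚ
  open import Data.Rational.Solver using (module +-*-Solver)
  open +-*-Solver

  falling : ℚ → ℕ → ℚ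
  falling y zero    = 1ℚ
  falling y (suc n) = (y - ℕtoℚ n) * falling y n

  falling-sucˡ : ∀ y n → falling y (suc n) ≡ y * falling (y - 1ℚ) n
  falling-sucˡ y zero    = solve 1 (λ y → (y :- con 0ℚ) :* con 1ℚ := y :* con 1ℚ) refl y
  falling-sucˡ y (suc n) = begin
    (y - ℕtoℚ (suc n)) * falling y (suc n)
      ≡⟨ cong₂ (λ k f → (y - k) * f) (ℕtoℚ-suc n) (falling-sucˡ y n) ⟩
    (y - (1ℚ + ℕtoℚ n)) * (y * falling (y - 1ℚ) n)
      ≡⟨ solve 3 (λ y k f → (y :- (con 1ℚ :+ k)) :* (y :* f) := y :* ((y :- con 1ℚ :- k) :* f)) refl y (ℕtoℚ n) _ ⟩
    y * falling (y - 1ℚ) (suc n) ∎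

  falling-neg : ∀ y n → falling (- y) n ≡ signℚ n * falling (y + ℕtoℚ n - 1ℚ) n
  falling-neg y zero    = refl
  falling-neg y (suc n) = begin
    (- y - ℕtoℚ n) * falling (- y) n
      ≡⟨ cong ((- y - ℕtoℚ n) *_) (falling-neg y n) ⟩
    (- y - ℕtoℚ n) * (signℚ n * falling (y + ℕtoℚ n - 1ℚ) n)
      ≡⟨ solve 4 (λ y k s f → (:- y :- k) :* (s :* f) := (:- s) :* ((y :+ (con 1ℚ :+ k) :- con 1ℚ) :* f)) refl y (ℕtoℚ n) (signℚ n) _ ⟩
    - signℚ n * ((y + (1ℚ + ℕtoℚ n) - 1ℚ) * falling (y + ℕtoℚ n - 1ℚ) n)
      ≡⟨ cong (λ z → - signℚ n * ((y + (1ℚ + ℕtoℚ n) - 1ℚ) * falling z n)) shift ⟩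
    - signℚ n * ((y + (1ℚ + ℕtoℚ n) - 1ℚ) * falling (y + (1ℚ + ℕtoℚ n) - 1ℚ - 1ℚ) n)
      ≡⟨ cong (- signℚ n *_) (falling-sucˡ (y + (1ℚ + ℕtoℚ n) - 1ℚ) n) ⟨
    - signℚ n * falling (y + (1ℚ + ℕtoℚ n) - 1ℚ) (suc n)
      ≡⟨ cong (λ k → - signℚ n * falling (y + k - 1ℚ) (suc n)) (ℕtoℚ-suc n) ⟨
    signℚ (suc n) * falling (y + ℕtoℚ (suc n) - 1ℚ) (suc n) ∎
    where
    shift : y + ℕtoℚ n - 1ℚ ≡ y + (1ℚ + ℕtoℚ n) - 1ℚ - 1ℚ
    shift = solve 2 (λ y k → y :+ k :- con 1ℚ := y :+ (con 1ℚ :+ k) :- con 1ℚ :- con 1ℚ) refl y (ℕtoℚ n)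

  falling-ℕ : ∀ N k → falling (ℕtoℚ N) k ≡ ℕtoℚ (k ! ℕ.* (N C k))
  falling-ℕ N       zero    = refl
  falling-ℕ zero    (suc k) = begin
    falling 0ℚ (suc k)              ≡⟨ falling-sucˡ 0ℚ k ⟩
    0ℚ * falling (0ℚ - 1ℚ) k        ≡⟨ ℚₚ.*-zeroˡ (falling (0ℚ - 1ℚ) k) ⟩
    0ℚ                              ≡⟨ cong ℕtoℚ (ℕₚ.*-zeroʳ (suc k !)) ⟨
    ℕtoℚ (suc k ! ℕ.* 0)            ∎
  falling-ℕ (suc N) (suc k) = begin
    falling (ℕtoℚ (suc N)) (suc k)
      ≡⟨ falling-sucˡ (ℕtoℚ (suc N)) k ⟩
    ℕtoℚ (suc N) * falling (ℕtoℚ (suc N) - 1ℚ) k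
      ≡⟨ cong (λ y → ℕtoℚ (suc N) * falling (y - 1ℚ) k) (ℕtoℚ-suc N) ⟩
    ℕtoℚ (suc N) * falling (1ℚ + ℕtoℚ N - 1ℚ) k
      ≡⟨ cong (λ y → ℕtoℚ (suc N) * falling y k) (solve 1 (λ x → con 1ℚ :+ x :- con 1ℚ := x) refl (ℕtoℚ N)) ⟩
    ℕtoℚ (suc N) * falling (ℕtoℚ N) k
      ≡⟨ cong (ℕtoℚ (suc N) *_) (falling-ℕ N k) ⟩
    ℕtoℚ (suc N) * ℕtoℚ (k ! ℕ.* (N C k))
      ≡⟨ ℕtoℚ-* (suc N) (k ! ℕ.* (N C k)) ⟨
    ℕtoℚ (suc N ℕ.* (k ! ℕ.* (N C k)))
      ≡⟨ cong ℕtoℚ ([1+k]!*[1+N]C[1+k]≡[1+N]*[k!*NCk] N k) ⟨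
    ℕtoℚ (suc k ! ℕ.* (suc N C suc k)) ∎

open FallingFactorial

module Polynomial where

  open import Data.Rational using (_+_; _-_; 0ℚ; 1ℚ; mkℚ; 1/_)
  import Data.Rational.Properties as ℚₚ
  open import Data.Integer.Base as ℤ using ()
  open import Data.Nat.Coprimality using (1-coprimeTo) renaming (sym to coprime-sym)
  open import Data.Rational.Solver using (module +-*-Solver)
  open +-*-Solver
  open ListSum ℚₚ.+-0-isCommutativeMonoid

  infixl 6 _+ₚ_
  infixr 7 _·ₚ_

  _+ₚ_ : Poly → Poly → Poly
  []      +ₚ q       = q
  (a ∷ p) +ₚ []      = a ∷ p
  (a ∷ p) +ₚ (b ∷ q) = (a + b) ∷ (p +ₚ q)

  _·ₚ_ : ℚ → Poly → Poly
  c ·ₚ p = map (c *_) p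

  mulXPlus : ℚ → Poly → Poly
  mulXPlus a p = (0ℚ ∷ p) +ₚ a ·ₚ p

  ∑ₚ : List Poly → Poly
  ∑ₚ = foldr _+ₚ_ []

  eval-+ₚ : ∀ p q x → eval (p +ₚ q) x ≡ eval p x + eval q x
  eval-+ₚ []      q       x = sym (ℚₚ.+-identityˡ _)
  eval-+ₚ (a ∷ p) []      x = sym (ℚₚ.+-identityʳ _)
  eval-+ₚ (a ∷ p) (b ∷ q) x = begin
    (a + b) + x * eval (p +ₚ q) x         ≡⟨ cong (λ z → (a + b) + x * z) (eval-+ₚ p q x) ⟩
    (a + b) + x * (eval p x + eval q x)   ≡⟨ solve 5 (λ a b x u v → (a :+ b) :+ x :* (u :+ v) := (a :+ x :* u) :+ (b :+ x :* v)) refl a b x (eval p x) (eval q x) ⟩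
    (a + x * eval p x) + (b + x * eval q x) ∎

  eval-·ₚ : ∀ c p x → eval (c ·ₚ p) x ≡ c * eval p x
  eval-·ₚ c []      x = sym (ℚₚ.*-zeroʳ c)
  eval-·ₚ c (a ∷ p) x = begin
    c * a + x * eval (c ·ₚ p) x   ≡⟨ cong (λ z → c * a + x * z) (eval-·ₚ c p x) ⟩
    c * a + x * (c * eval p x)    ≡⟨ solve 4 (λ c a x u → c :* a :+ x :* (c :* u) := c :* (a :+ x :* u)) refl c a x (eval p x) ⟩
    c * (a + x * eval p x)        ∎

  eval-mulXPlus : ∀ a p x → eval (mulXPlus a p) x ≡ (x + a) * eval p x
  eval-mulXPlus a p x = begin
    eval ((0ℚ ∷ p) +ₚ a ·ₚ p) x          ≡⟨ eval-+ₚ (0ℚ ∷ p) (a ·ₚ p) x ⟩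
    (0ℚ + x * eval p x) + eval (a ·ₚ p) x ≡⟨ cong ((0ℚ + x * eval p x) +_) (eval-·ₚ a p x) ⟩
    (0ℚ + x * eval p x) + a * eval p x    ≡⟨ solve 3 (λ a x u → (con 0ℚ :+ x :* u) :+ a :* u := (x :+ a) :* u) refl a x (eval p x) ⟩
    (x + a) * eval p x                    ∎

  eval-∑ₚ : ∀ ps x → eval (∑ₚ ps) x ≡ ∑ (map (λ p → eval p x) ps)
  eval-∑ₚ []       x = refl
  eval-∑ₚ (p ∷ ps) x = trans (eval-+ₚ p (∑ₚ ps) x) (cong (eval p x +_) (eval-∑ₚ ps x))

  fallingPoly : ℚ → ℕ → Poly
  fallingPoly a zero    = 1ℚ ∷ []
  fallingPoly a (suc n) = mulXPlus (a - ℕtoℚ n) (fallingPoly a n)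

  eval-fallingPoly : ∀ a n x → eval (fallingPoly a n) x ≡ falling (x + a) n
  eval-fallingPoly a zero    x = solve 1 (λ x → con 1ℚ :+ x :* con 0ℚ := con 1ℚ) refl x
  eval-fallingPoly a (suc n) x = begin
    eval (mulXPlus (a - ℕtoℚ n) (fallingPoly a n)) x ≡⟨ eval-mulXPlus (a - ℕtoℚ n) (fallingPoly a n) x ⟩
    (x + (a - ℕtoℚ n)) * eval (fallingPoly a n) x    ≡⟨ cong₂ _*_ (solve 3 (λ x a k → x :+ (a :- k) := x :+ a :- k) refl x a (ℕtoℚ n)) (eval-fallingPoly a n x) ⟩
    (x + a - ℕtoℚ n) * falling (x + a) n             ∎

  -- n! written in normal form, so that the instance n !≢0 shows that it is non-zero
  n!ℚ : ℕ → ℚ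
  n!ℚ n = mkℚ (ℤ.+ (n !)) 0 (coprime-sym (1-coprimeTo (n !)))

  1/n! : ℕ → ℚ
  1/n! n = (1/ n!ℚ n) {{n ℕₚ.!≢0}}

  1/n!*n!≡1 : ∀ n → 1/n! n * ℕtoℚ (n !) ≡ 1ℚ
  1/n!*n!≡1 n = trans (cong (1/n! n *_) (ℕtoℚ≡mkℚ (n !))) (ℚₚ.*-inverseˡ (n!ℚ n) {{n ℕₚ.!≢0}})

  binomialPoly : ℚ → ℕ → Poly
  binomialPoly a n = 1/n! n ·ₚ fallingPoly a n

  eval-binomialPoly : ∀ a n x → eval (binomialPoly a n) x ≡ 1/n! n * falling (x + a) n
  eval-binomialPoly a n x = trans (eval-·ₚ (1/n! n) (fallingPoly a n) x) (cong (1/n! n *_) (eval-fallingPoly a n x))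

  eval-binomialPoly-ℕ : ∀ c n m → eval (binomialPoly (ℕtoℚ c) n) (ℕtoℚ m) ≡ ℕtoℚ ((m ℕ.+ c) C n)
  eval-binomialPoly-ℕ c n m = begin
    eval (binomialPoly (ℕtoℚ c) n) (ℕtoℚ m)         ≡⟨ eval-binomialPoly (ℕtoℚ c) n (ℕtoℚ m) ⟩
    1/n! n * falling (ℕtoℚ m + ℕtoℚ c) n            ≡⟨ cong (λ y → 1/n! n * falling y n) (ℕtoℚ-+ m c) ⟨
    1/n! n * falling (ℕtoℚ (m ℕ.+ c)) n             ≡⟨ cong (1/n! n *_) (falling-ℕ (m ℕ.+ c) n) ⟩
    1/n! n * ℕtoℚ (n ! ℕ.* binomial)               ≡⟨ cong (1/n! n *_) (ℕtoℚ-* (n !) binomial) ⟩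
    1/n! n * (ℕtoℚ (n !) * ℕtoℚ binomial)          ≡⟨ ℚₚ.*-assoc (1/n! n) (ℕtoℚ (n !)) _ ⟨
    (1/n! n * ℕtoℚ (n !)) * ℕtoℚ binomial          ≡⟨ cong (_* ℕtoℚ binomial) (1/n!*n!≡1 n) ⟩
    1ℚ * ℕtoℚ binomial                              ≡⟨ ℚₚ.*-identityˡ _ ⟩
    ℕtoℚ binomial                                   ∎
    where
    binomial = (m ℕ.+ c) C n

  eval-binomialPoly-neg : ∀ a n x → eval (binomialPoly a n) (- x) ≡ signℚ n * eval (binomialPoly (ℕtoℚ n - 1ℚ - a) n) x
  eval-binomialPoly-neg a n x = begin
    eval (binomialPoly a n) (- x)                               ≡⟨ eval-binomialPoly a n (- x) ⟩
    1/n! n * falling (- x + a) n                                ≡⟨ cong (λ y → 1/n! n * falling y n) (solve 2 (λ x a → :- x :+ a := :- (x :- a)) refl x a) ⟩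
    1/n! n * falling (- (x - a)) n                              ≡⟨ cong (1/n! n *_) (falling-neg (x - a) n) ⟩
    1/n! n * (signℚ n * falling (x - a + ℕtoℚ n - 1ℚ) n)        ≡⟨ cong (λ y → 1/n! n * (signℚ n * falling y n)) (solve 3 (λ x a k → x :- a :+ k :- con 1ℚ := x :+ (k :- con 1ℚ :- a)) refl x a (ℕtoℚ n)) ⟩
    1/n! n * (signℚ n * falling (x + (ℕtoℚ n - 1ℚ - a)) n)      ≡⟨ solve 3 (λ c s f → c :* (s :* f) := s :* (c :* f)) refl (1/n! n) (signℚ n) _ ⟩
    signℚ n * (1/n! n * falling (x + (ℕtoℚ n - 1ℚ - a)) n)      ≡⟨ cong (signℚ n *_) (eval-binomialPoly (ℕtoℚ n - 1ℚ - a) n x) ⟨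
    signℚ n * eval (binomialPoly (ℕtoℚ n - 1ℚ - a) n) x        ∎

open Polynomial

module RedeiBergePolynomial where

  open import Data.Rational using (_+_; _-_; 1ℚ)
  import Data.Rational.Properties as ℚₚ
  open import Data.Rational.Solver using (module +-*-Solver)
  open +-*-Solver
  open ListSum ℚₚ.+-0-isCommutativeMonoid

  *-∑ : ∀ {B : Set} c (f : B → ℚ) (l : List B) → ∑ (map (λ y → c * f y) l) ≡ c * ∑ (map f l)
  *-∑ c f []      = sym (ℚₚ.*-zeroʳ c)
  *-∑ c f (y ∷ l) = trans (cong (c * f y +_) (*-∑ c f l)) (sym (ℚₚ.*-distribˡ-+ c (f y) _))

  binomialPoly-complement : ∀ {n} (X : Digraph n) → IsTournament X → ∀ σ → σ ∈ listings n →
    binomialPoly (ℕtoℚ n - 1ℚ - ℕtoℚ (nonDescents (edge X) σ)) n ≡ binomialPoly (ℕtoℚ (nonDescents (edge X) (reverse σ))) n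
  -- For n = 0 the two shifts differ (-1 and 0), but binomialPoly _ 0 does not depend on the shift.
  binomialPoly-complement {zero}  X tournament σ       σ∈ = refl
  binomialPoly-complement {suc k} X tournament []      σ∈ = ⊥-elim (ℕₚ.0≢1+n (proj₁ (∈-listings⁻ (suc k) σ∈)))
  binomialPoly-complement {suc k} X tournament (a ∷ τ) σ∈ = cong (λ c → binomialPoly c (suc k)) (begin
    ℕtoℚ (suc k) - 1ℚ - ℕtoℚ D                  ≡⟨ cong (λ j → ℕtoℚ (suc j) - 1ℚ - ℕtoℚ D) D+D′≡k ⟨
    ℕtoℚ (suc (D ℕ.+ D′)) - 1ℚ - ℕtoℚ D         ≡⟨ cong (λ q → q - 1ℚ - ℕtoℚ D) (trans (ℕtoℚ-suc (D ℕ.+ D′)) (cong (1ℚ +_) (ℕtoℚ-+ D D′))) ⟩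
    1ℚ + (ℕtoℚ D + ℕtoℚ D′) - 1ℚ - ℕtoℚ D       ≡⟨ solve 2 (λ d d′ → con 1ℚ :+ (d :+ d′) :- con 1ℚ :- d := d′) refl (ℕtoℚ D) (ℕtoℚ D′) ⟩
    ℕtoℚ D′                                     ∎)
    where
    listed = ∈-listings⁻ (suc k) σ∈
    D  = nonDescents (edge X) (a ∷ τ)
    D′ = nonDescents (edge X) (reverse (a ∷ τ))
    D+D′≡k : D ℕ.+ D′ ≡ k
    D+D′≡k = trans (nonDescents-+-reverse X tournament a τ (proj₂ listed)) (ℕₚ.suc-injective (proj₁ listed))

  module _ {n : ℕ} (X : Digraph n) where

    binomialTerm : List (Fin n) → Poly
    binomialTerm σ = binomialPoly (ℕtoℚ (nonDescents (edge X) σ)) n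

    redeiBergePoly : Poly
    redeiBergePoly = ∑ₚ (map binomialTerm (listings n))

    eval-redeiBergePoly : ∀ x → eval redeiBergePoly x ≡ ∑ (map (λ σ → eval (binomialTerm σ) x) (listings n))
    eval-redeiBergePoly x = trans (eval-∑ₚ (map binomialTerm (listings n)) x) (cong ∑ (sym (map-∘ (listings n))))

    redeiBergePoly-interpolates : ∀ m → eval redeiBergePoly (ℕtoℚ m) ≡ ℕtoℚ (redeiBerge X m)
    redeiBergePoly-interpolates m = begin
      eval redeiBergePoly (ℕtoℚ m)
        ≡⟨ eval-redeiBergePoly (ℕtoℚ m) ⟩
      ∑ (map (λ σ → eval (binomialTerm σ) (ℕtoℚ m)) (listings n))
        ≡⟨ cong ∑ (map-cong (λ σ → eval-binomialPoly-ℕ (nonDescents (edge X) σ) n m) (listings n)) ⟩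
      ∑ (map (λ σ → ℕtoℚ ((m ℕ.+ nonDescents (edge X) σ) C n)) (listings n))
        ≡⟨ ∑-cong-∈ (listings n) (λ {σ} σ∈ → cong ℕtoℚ (sym (FDes1≡C X σ m (proj₁ (∈-listings⁻ n σ∈))))) ⟩
      ∑ (map (λ σ → ℕtoℚ (FDes1 X σ m)) (listings n))
        ≡⟨ ℕtoℚ-sum (λ σ → FDes1 X σ m) (listings n) ⟨
      ℕtoℚ (redeiBerge X m) ∎

    redeiBergePoly-reciprocity : IsTournament X → ∀ x → eval redeiBergePoly (- x) ≡ signℚ n * eval redeiBergePoly x
    redeiBergePoly-reciprocity tournament x = begin
      eval redeiBergePoly (- x)
        ≡⟨ eval-redeiBergePoly (- x) ⟩
      ∑ (map (λ σ → eval (binomialTerm σ) (- x)) (listings n))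
        ≡⟨ cong ∑ (map-cong (λ σ → eval-binomialPoly-neg _ n x) (listings n)) ⟩
      ∑ (map (λ σ → signℚ n * eval (binomialPoly (ℕtoℚ n - 1ℚ - ℕtoℚ (nonDescents (edge X) σ)) n) x) (listings n))
        ≡⟨ ∑-cong-∈ (listings n) (λ {σ} σ∈ → cong (λ p → signℚ n * eval p x) (binomialPoly-complement X tournament σ σ∈)) ⟩
      ∑ (map (λ σ → signℚ n * eval (binomialTerm (reverse σ)) x) (listings n))
        ≡⟨ *-∑ (signℚ n) (λ σ → eval (binomialTerm (reverse σ)) x) (listings n) ⟩
      signℚ n * ∑ (map (λ σ → eval (binomialTerm (reverse σ)) x) (listings n))
        ≡⟨ cong (signℚ n *_) (∑-listings-reverse n (λ σ → eval (binomialTerm σ) x)) ⟩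
      signℚ n * ∑ (map (λ σ → eval (binomialTerm σ) x) (listings n))
        ≡⟨ cong (signℚ n *_) (eval-redeiBergePoly x) ⟨
      signℚ n * eval redeiBergePoly x ∎

open RedeiBergePolynomial

mainTheorem11 : (n : ℕ) (X : Digraph n) → IsTournament X →
    Σ Poly (λ p →
    ((m : ℕ) → eval p (ℕtoℚ m) ≡ ℕtoℚ (redeiBerge X m))
    × ((x : ℚ) → eval p (- x) ≡ signℚ n * eval p x))
mainTheorem11 n X tournament = redeiBergePoly X , redeiBergePoly-interpolates X , redeiBergePoly-reciprocity X tournament
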